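{- Assume the following Conjecture holds: for every positive integer $n$ and every system $T\subseteq\{x_i+1=x_k,\ x_i\cdot x_j=x_k:\ i,j,k\in\{1,\ldots,n\}\}$ which has only finitely many solutions in positive integers $x_1,\ldots,x_n$, each such solution satisfies $x_1,\ldots,x_n\leqslant f(n)$. Then there is an algorithm which, given any polynomial $D(x_1,\ldots,x_p)$ with integer coefficients such that the equation $D(x_1,\ldots,x_p)=0$ has only finitely many solutions in positive integers, computes an integer that bounds from above all entries of all these solutions.
   Context: Define $f:\mathbb{N}\setminus\{0\}\to\mathbb{N}\setminus\{0\}$ by $f(1)=1$, $f(n)=2^{2^{n-2}}$ for $n\in\{2,3,4,5\}$, and $f(n)=\left(2+2^{2^{n-4}}\right)^{2^{n-4}}$ for $n\geqslant 6$. -}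

module Defs where

open import Data.Nat using (ℕ; zero; suc; _+_; _*_; _∸_; _^_; _≤_)
open import Data.Integer as ℤ using (ℤ)
open import Data.Fin using (Fin)
open import Data.Vec using (Vec; lookup)
open import Data.List using (List)
open import Data.List.Relation.Unary.All using (All)
open import Data.List.Membership.Propositional using (_∈_)
open import Data.Product using (Σ; _×_)
open import Relation.Binary.PropositionalEquality using (_≡_)

-- The function f from the paper (f 0 is an unused dummy value).
f : ℕ → ℕ
f 0 = 1
f 1 = 1
f 2 = 2 ^ (2 ^ 0)
f 3 = 2 ^ (2 ^ 1)
f 4 = 2 ^ (2 ^ 2)
f 5 = 2 ^ (2 ^ 3)
f n@(suc (suc (suc (suc (suc (suc _)))))) = (2 + 2 ^ (2 ^ (n ∸ 4))) ^ (2 ^ (n ∸ 4))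

data Poly (p : ℕ) : Set where
  var  : Fin p → Poly p
  con  : ℤ → Poly p
  _⊕_  : Poly p → Poly p → Poly p
  _⊗_  : Poly p → Poly p → Poly p

eval : ∀ {p} → Poly p → Vec ℕ p → ℤ
eval (var i) x = ℤ.+ (lookup x i)
eval (con c) x = c
eval (a ⊕ b) x = eval a x ℤ.+ eval b x
eval (a ⊗ b) x = eval a x ℤ.* eval b x

Positive : ∀ {n} → Vec ℕ n → Set
Positive x = ∀ i → 1 ≤ lookup x i

PolySol : ∀ {p} → Poly p → Vec ℕ p → Set
PolySol D x = Positive x × eval D x ≡ ℤ.0ℤ

data Eqn (n : ℕ) : Set where
  addOne : Fin n → Fin n → Eqn n
  mulEq  : Fin n → Fin n → Fin n → Eqn n

Holds : ∀ {n} → Eqn n → Vec ℕ n → Set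
Holds (addOne i k) x = lookup x i + 1 ≡ lookup x k
Holds (mulEq i j k) x = lookup x i * lookup x j ≡ lookup x k

SysSol : ∀ {n} → List (Eqn n) → Vec ℕ n → Set
SysSol T x = Positive x × All (λ e → Holds e x) T

FinitelyMany : ∀ {n} → (Vec ℕ n → Set) → Set
FinitelyMany {n} P = Σ (List (Vec ℕ n)) λ L → ∀ x → P x → x ∈ L

Conjecture : Set
Conjecture = ∀ (n : ℕ) → 1 ≤ n → (T : List (Eqn n)) → FinitelyMany (SysSol T) →
             ∀ x → SysSol T x → ∀ i → lookup x i ≤ f n

{-# OPTIONS --safe #-}
-- A polynomial D with integer coefficients is a difference A - B of terms built from 1 and the
-- unknowns by + and *, so that D = 0 becomes A = B. Introducing one new unknown for every
-- intermediate value of A and B turns A = B into a system of equations x + 1 = y and x * y = z;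
-- for addition this needs a small gadget, since sums are not among the allowed equations.
-- Every positive solution of D = 0 extends to a positive solution of the system, and the values
-- of the new unknowns are forced by the old ones. Hence the system has only finitely many
-- solutions when D = 0 has, and the Conjecture bounds them by f of the number of unknowns,
-- a number computed from D.
module Submission where

open import Defs
open import Data.Nat using (ℕ; zero; suc; _+_; _*_; _≤_; s≤s; z≤n)
open import Data.Nat.Properties using (*-cancelʳ-≡; *-identityˡ; *-identityʳ; +-cancelˡ-≡; *-cancelˡ-≡; *-mono-≤; m≤n⇒m≤n+o; m≤n+m; module ≤-Reasoning)
open import Data.Nat.Tactic.RingSolver using (solve-∀)
open import Data.Integer using (ℤ; +_; -[1+_]; _-_)
import Data.Integer as ℤ
open import Data.Integer.Properties using (pos-+; pos-*; +-injective; i-j≡0⇒i≡j; i≡j⇒i-j≡0)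
import Data.Integer.Tactic.RingSolver as ℤ-Solver
open import Data.Fin using (Fin; zero; suc)
open import Data.Fin.Properties using (+↔⊎)
open import Data.Vec using (Vec; []; _∷_; lookup; tabulate)
import Data.Vec as Vec
open import Data.Vec.Properties using (lookup∘tabulate; tabulate∘lookup; tabulate-cong; tabulate-∘)
open import Data.Vec.Relation.Unary.All as VecAll using ([]; _∷_)
import Data.Vec.Relation.Unary.All.Properties as VecAll
open import Data.List using (List; []; _∷_; map; _++_)
open import Data.List.Relation.Unary.All as All using (All; []; _∷_)
import Data.List.Relation.Unary.All.Properties as AllP
open import Data.List.Membership.Propositional using (_∈_)
open import Data.List.Membership.Propositional.Properties using (∈-map⁺)
open import Data.Product using (Σ; _×_; _,_; proj₁; proj₂)
open import Data.Sum using (_⊎_; inj₁; inj₂)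
open import Data.Sum.Function.Propositional using (_⊎-↔_)
open import Function using (_∘_; id; Inverse; _↔_)
open import Function.Properties.Inverse using (↔-refl; ↔-sym; ↔-trans)
open import Relation.Binary.PropositionalEquality

private
  variable
    p n : ℕ
    V W : Set

data Equation (V : Set) : Set where
  inc : V → V → Equation V
  mul : V → V → V → Equation V

holds : (V → ℕ) → Equation V → Set
holds v (inc x y) = v x + 1 ≡ v y
holds v (mul x y z) = v x * v y ≡ v z

infix 4 _⊨_
_⊨_ : (V → ℕ) → List (Equation V) → Set
v ⊨ es = All (holds v) es

rename : (V → W) → Equation V → Equation W
rename g (inc x y) = inc (g x) (g y)
rename g (mul x y z) = mul (g x) (g y) (g z)

⊨-rename⁺ : {v : W → ℕ} {g : V → W} (es : List (Equation V)) → v ∘ g ⊨ es → v ⊨ map (rename g) es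
⊨-rename⁺ [] [] = []
⊨-rename⁺ (inc x y ∷ es) (h ∷ hs) = h ∷ ⊨-rename⁺ es hs
⊨-rename⁺ (mul x y z ∷ es) (h ∷ hs) = h ∷ ⊨-rename⁺ es hs

⊨-rename⁻ : {v : W → ℕ} {g : V → W} (es : List (Equation V)) → v ⊨ map (rename g) es → v ∘ g ⊨ es
⊨-rename⁻ [] [] = []
⊨-rename⁻ (inc x y ∷ es) (h ∷ hs) = h ∷ ⊨-rename⁻ es hs
⊨-rename⁻ (mul x y z ∷ es) (h ∷ hs) = h ∷ ⊨-rename⁻ es hs

holds-resp-≗ : {v u : V → ℕ} → v ≗ u → ∀ e → holds v e → holds u e
holds-resp-≗ v≗u (inc x y) = subst₂ (λ a b → a + 1 ≡ b) (v≗u x) (v≗u y)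
holds-resp-≗ v≗u (mul x y z) h = trans (cong₂ _*_ (sym (v≗u x)) (sym (v≗u y))) (trans h (v≗u z))

⊨-resp-≗ : {v u : V → ℕ} {es : List (Equation V)} → v ≗ u → v ⊨ es → u ⊨ es
⊨-resp-≗ v≗u = All.map (holds-resp-≗ v≗u _)

data Op : Set where
  plus times : Op

⟦_⟧ₒ : Op → ℕ → ℕ → ℕ
⟦ plus ⟧ₒ = _+_
⟦ times ⟧ₒ = _*_

width : Op → ℕ
width plus = 10
width times = 1

result : (o : Op) → Fin (width o)
result plus = zero
result times = zero

block : (o : Op) → ℕ → ℕ → Vec ℕ (width o)
block plus X Y = let z = X + Y in
  z ∷ z * X ∷ z * X + 1 ∷ z * Y ∷ z * Y + 1 ∷ (z * X + 1) * (z * Y + 1) ∷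
  X * Y ∷ X * Y + 1 ∷ z * z ∷ z * z * (X * Y + 1) ∷ []
block times X Y = X * Y ∷ []

-- Addition is encoded through z²(XY + 1) + 1 = (zX + 1)(zY + 1), whose only positive root is z = X + Y.
gadget : (o : Op) → V → V → Vec V (width o) → List (Equation V)
gadget plus x y (z ∷ zx ∷ zx+1 ∷ zy ∷ zy+1 ∷ r ∷ xy ∷ xy+1 ∷ zz ∷ l ∷ []) =
  mul z x zx ∷ inc zx zx+1 ∷ mul z y zy ∷ inc zy zy+1 ∷ mul zx+1 zy+1 r ∷
  mul x y xy ∷ inc xy xy+1 ∷ mul z z zz ∷ mul zz xy+1 l ∷ inc l r ∷ []
gadget times x y (z ∷ []) = mul x y z ∷ []

block-result : ∀ o X Y → lookup (block o X Y) (result o) ≡ ⟦ o ⟧ₒ X Y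
block-result plus X Y = refl
block-result times X Y = refl

block-positive : ∀ o {X Y} → 1 ≤ X → 1 ≤ Y → VecAll.All (1 ≤_) (block o X Y)
block-positive plus {X} {Y} 1≤X 1≤Y =
  1≤z ∷ 1≤zX ∷ 1≤suc ∷ 1≤zY ∷ 1≤suc ∷ *-mono-≤ (1≤suc {(X + Y) * X}) (1≤suc {(X + Y) * Y}) ∷
  *-mono-≤ 1≤X 1≤Y ∷ 1≤suc ∷ *-mono-≤ 1≤z 1≤z ∷ *-mono-≤ (*-mono-≤ 1≤z 1≤z) 1≤suc ∷ []
  where
  1≤suc : ∀ {a} → 1 ≤ a + 1
  1≤suc {a} = m≤n+m 1 a
  1≤z = m≤n⇒m≤n+o Y 1≤X
  1≤zX = *-mono-≤ 1≤z 1≤X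
  1≤zY = *-mono-≤ 1≤z 1≤Y
block-positive times 1≤X 1≤Y = *-mono-≤ 1≤X 1≤Y ∷ []

block-satisfies : ∀ o X Y → id ⊨ gadget o X Y (block o X Y)
block-satisfies plus X Y = refl ∷ refl ∷ refl ∷ refl ∷ refl ∷ refl ∷ refl ∷ refl ∷ refl ∷
  addition-identity X Y ∷ []
  where
  addition-identity : ∀ X Y → (X + Y) * (X + Y) * (X * Y + 1) + 1 ≡ ((X + Y) * X + 1) * ((X + Y) * Y + 1)
  addition-identity = solve-∀
block-satisfies times X Y = refl ∷ []

addition-root : ∀ z X Y → 1 ≤ z → z * z * (X * Y + 1) + 1 ≡ (z * X + 1) * (z * Y + 1) → z ≡ X + Y
addition-root z@(suc _) X Y _ eq = *-cancelˡ-≡ z (X + Y) z (+-cancelˡ-≡ (z * z * (X * Y) + 1) _ _ (begin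
  z * z * (X * Y) + 1 + z * z       ≡⟨ expand-left z X Y ⟩
  z * z * (X * Y + 1) + 1           ≡⟨ eq ⟩
  (z * X + 1) * (z * Y + 1)         ≡⟨ expand-right z X Y ⟩
  z * z * (X * Y) + 1 + z * (X + Y) ∎))
  where
  open ≡-Reasoning
  expand-left : ∀ z X Y → z * z * (X * Y) + 1 + z * z ≡ z * z * (X * Y + 1) + 1
  expand-left = solve-∀
  expand-right : ∀ z X Y → (z * X + 1) * (z * Y + 1) ≡ z * z * (X * Y) + 1 + z * (X + Y)
  expand-right = solve-∀

gadget-forces-block : ∀ o {X Y} zs → VecAll.All (1 ≤_) zs → id ⊨ gadget o X Y zs → zs ≡ block o X Y
gadget-forces-block plus {X} {Y} (z ∷ _ ∷ _ ∷ _ ∷ _ ∷ _ ∷ _ ∷ _ ∷ _ ∷ _ ∷ []) (1≤z ∷ _)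
  (refl ∷ refl ∷ refl ∷ refl ∷ refl ∷ refl ∷ refl ∷ refl ∷ refl ∷ eq ∷ [])
  with refl ← addition-root z X Y 1≤z eq = refl
gadget-forces-block times (_ ∷ []) _ (refl ∷ []) = refl

gadget-rename : ∀ o (g : V → W) x y zs → map (rename g) (gadget o x y zs) ≡ gadget o (g x) (g y) (Vec.map g zs)
gadget-rename plus g x y (_ ∷ _ ∷ _ ∷ _ ∷ _ ∷ _ ∷ _ ∷ _ ∷ _ ∷ _ ∷ []) = refl
gadget-rename times g x y (_ ∷ []) = refl

gadget-satisfied : ∀ o (v : V → ℕ) {x y} zs → Vec.map v zs ≡ block o (v x) (v y) → v ⊨ gadget o x y zs
gadget-satisfied o v {x} {y} zs eq = ⊨-rename⁻ (gadget o x y zs)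
  (subst (id ⊨_) (sym (gadget-rename o v x y zs))
    (subst (λ ws → id ⊨ gadget o (v x) (v y) ws) (sym eq) (block-satisfies o (v x) (v y))))

gadget-solution : ∀ o (v : V → ℕ) {x y} zs → (∀ w → 1 ≤ v w) → v ⊨ gadget o x y zs →
                  Vec.map v zs ≡ block o (v x) (v y)
gadget-solution o v {x} {y} zs positive hs = gadget-forces-block o (Vec.map v zs)
  (VecAll.map⁺ (VecAll.universal positive zs))
  (subst (id ⊨_) (gadget-rename o v x y zs) (⊨-rename⁺ (gadget o x y zs) hs))

data Code : Set where
  fin : ℕ → Code
  _⊞_ : Code → Code → Code

El : Code → Set
El (fin n) = Fin n
El (a ⊞ b) = El a ⊎ El b

size : Code → ℕ
size (fin n) = n
size (a ⊞ b) = size a + size b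

El↔Fin : ∀ c → El c ↔ Fin (size c)
El↔Fin (fin n) = ↔-refl
El↔Fin (a ⊞ b) = ↔-trans (El↔Fin a ⊎-↔ El↔Fin b) (↔-sym +↔⊎)

data Term (p : ℕ) : Set where
  one   : Term p
  input : Fin p → Term p
  node  : Op → Term p → Term p → Term p

⟦_⟧ : Term p → Vec ℕ p → ℕ
⟦ one ⟧ x = 1
⟦ input i ⟧ x = lookup x i
⟦ node o t u ⟧ x = ⟦ o ⟧ₒ (⟦ t ⟧ x) (⟦ u ⟧ x)

auxCode : Term p → Code
auxCode one = fin 0
auxCode (input i) = fin 0
auxCode (node o t u) = (auxCode t ⊞ auxCode u) ⊞ fin (width o)

varCode : Term p → Code
varCode {p} t = (fin 1 ⊞ fin p) ⊞ auxCode t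

Var : Term p → Set
Var t = El (varCode t)

pattern one-var = inj₁ (inj₁ zero)
pattern input-var i = inj₁ (inj₂ i)

module _ {o : Op} {t u : Term p} where

  left : Var t → Var (node o t u)
  left (inj₁ b) = inj₁ b
  left (inj₂ w) = inj₂ (inj₁ (inj₁ w))

  right : Var u → Var (node o t u)
  right (inj₁ b) = inj₁ b
  right (inj₂ w) = inj₂ (inj₁ (inj₂ w))

  aux : Fin (width o) → Var (node o t u)
  aux k = inj₂ (inj₂ k)

output : (t : Term p) → Var t
output one = one-var
output (input i) = input-var i
output (node o t u) = aux (result o)

equations : (t : Term p) → List (Equation (Var t))
equations one = []
equations (input i) = []
equations (node o t u) =
  gadget o (left (output t)) (right (output u)) (tabulate aux) ++
  map (rename left) (equations t) ++ map (rename right) (equations u)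

canonical : (t : Term p) → Vec ℕ p → Var t → ℕ
canonical t x one-var = 1
canonical t x (input-var i) = lookup x i
canonical (node o t u) x (inj₂ (inj₁ (inj₁ w))) = canonical t x (inj₂ w)
canonical (node o t u) x (inj₂ (inj₁ (inj₂ w))) = canonical u x (inj₂ w)
canonical (node o t u) x (inj₂ (inj₂ k)) = lookup (block o (⟦ t ⟧ x) (⟦ u ⟧ x)) k

canonical-output : ∀ (t : Term p) x → canonical t x (output t) ≡ ⟦ t ⟧ x
canonical-output one x = refl
canonical-output (input i) x = refl
canonical-output (node o t u) x = block-result o (⟦ t ⟧ x) (⟦ u ⟧ x)

module _ {o : Op} {t u : Term p} (x : Vec ℕ p) where

  canonical-left : canonical (node o t u) x ∘ left ≗ canonical t x
  canonical-left one-var = refl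
  canonical-left (input-var i) = refl
  canonical-left (inj₂ w) = refl

  canonical-right : canonical (node o t u) x ∘ right ≗ canonical u x
  canonical-right one-var = refl
  canonical-right (input-var i) = refl
  canonical-right (inj₂ w) = refl

canonical-positive : ∀ (t : Term p) {x} → Positive x → ∀ w → 1 ≤ canonical t x w
canonical-positive t positive one-var = s≤s z≤n
canonical-positive t positive (input-var i) = positive i
canonical-positive (node o t u) positive (inj₂ (inj₁ (inj₁ w))) = canonical-positive t positive (inj₂ w)
canonical-positive (node o t u) positive (inj₂ (inj₁ (inj₂ w))) = canonical-positive u positive (inj₂ w)
canonical-positive (node o t u) {x} positive (inj₂ (inj₂ k)) =
  VecAll.lookup⁺ (block-positive o (value-positive t) (value-positive u)) k
  where
  value-positive : ∀ t → 1 ≤ ⟦ t ⟧ x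
  value-positive t = subst (1 ≤_) (canonical-output t x) (canonical-positive t positive (output t))

canonical-satisfies : ∀ (t : Term p) x → canonical t x ⊨ equations t
canonical-satisfies one x = []
canonical-satisfies (input i) x = []
canonical-satisfies (node o t u) x =
  AllP.++⁺ (gadget-satisfied o v (tabulate aux) aux-values)
    (AllP.++⁺ (⊨-rename⁺ (equations t) (⊨-resp-≗ (sym ∘ canonical-left x) (canonical-satisfies t x)))
              (⊨-rename⁺ (equations u) (⊨-resp-≗ (sym ∘ canonical-right x) (canonical-satisfies u x))))
  where
  open ≡-Reasoning
  v = canonical (node o t u) x
  aux-values : Vec.map v (tabulate aux) ≡ block o (v (left (output t))) (v (right (output u)))
  aux-values = begin
    Vec.map v (tabulate aux)                          ≡⟨ tabulate-∘ v aux ⟨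
    tabulate (lookup (block o (⟦ t ⟧ x) (⟦ u ⟧ x)))   ≡⟨ tabulate∘lookup _ ⟩
    block o (⟦ t ⟧ x) (⟦ u ⟧ x)                      ≡⟨ cong₂ (block o) (trans (canonical-left x (output t)) (canonical-output t x))
                                                                         (trans (canonical-right x (output u)) (canonical-output u x)) ⟨
    block o (v (left (output t))) (v (right (output u))) ∎

canonical-unique : ∀ (t : Term p) (v : Var t → ℕ) x → (∀ i → v (input-var i) ≡ lookup x i) →
                   v one-var ≡ 1 → (∀ w → 1 ≤ v w) → v ⊨ equations t → v ≗ canonical t x
canonical-unique t v x inputs v-one positive hs one-var = v-one
canonical-unique t v x inputs v-one positive hs (input-var i) = inputs i
canonical-unique (node o t u) v x inputs v-one positive hs (inj₂ w) = auxiliary w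
  where
  open ≡-Reasoning
  G = gadget o (left (output t)) (right (output u)) (tabulate aux)
  L = map (rename left) (equations t)
  from-t : v ∘ left ≗ canonical t x
  from-t = canonical-unique t (v ∘ left) x inputs v-one (positive ∘ left)
             (⊨-rename⁻ (equations t) (AllP.++⁻ˡ L (AllP.++⁻ʳ G hs)))
  from-u : v ∘ right ≗ canonical u x
  from-u = canonical-unique u (v ∘ right) x inputs v-one (positive ∘ right)
             (⊨-rename⁻ (equations u) (AllP.++⁻ʳ L (AllP.++⁻ʳ G hs)))
  aux-values : tabulate (v ∘ aux) ≡ block o (⟦ t ⟧ x) (⟦ u ⟧ x)
  aux-values = begin
    tabulate (v ∘ aux)                                    ≡⟨ tabulate-∘ v aux ⟩
    Vec.map v (tabulate aux)                              ≡⟨ gadget-solution o v (tabulate aux) positive (AllP.++⁻ˡ G hs) ⟩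
    block o (v (left (output t))) (v (right (output u)))  ≡⟨ cong₂ (block o) (trans (from-t (output t)) (canonical-output t x))
                                                                            (trans (from-u (output u)) (canonical-output u x)) ⟩
    block o (⟦ t ⟧ x) (⟦ u ⟧ x)                          ∎
  auxiliary : ∀ w → v (inj₂ w) ≡ canonical (node o t u) x (inj₂ w)
  auxiliary (inj₁ (inj₁ w)) = from-t (inj₂ w)
  auxiliary (inj₁ (inj₂ w)) = from-u (inj₂ w)
  auxiliary (inj₂ k) = trans (sym (lookup∘tabulate (v ∘ aux) k)) (cong (λ b → lookup b k) aux-values)

numeral : ℕ → Term p
numeral zero = one
numeral (suc n) = node plus one (numeral n)

⟦numeral⟧ : ∀ n (x : Vec ℕ p) → ⟦ numeral n ⟧ x ≡ suc n
⟦numeral⟧ zero x = refl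
⟦numeral⟧ (suc n) x = cong suc (⟦numeral⟧ n x)

Difference : ℕ → Set
Difference p = Term p × Term p

⟦_⟧ᵈ : Difference p → Vec ℕ p → ℤ
⟦ a , b ⟧ᵈ x = + ⟦ a ⟧ x - + ⟦ b ⟧ x

_⊕ᵈ_ : Difference p → Difference p → Difference p
(a , b) ⊕ᵈ (c , d) = node plus a c , node plus b d

_⊗ᵈ_ : Difference p → Difference p → Difference p
(a , b) ⊗ᵈ (c , d) = node plus (node times a c) (node times b d) , node plus (node times a d) (node times b c)

-- Terms only take positive values, so an unknown or a constant c ≥ 0 becomes (c + 1) - 1,
-- and a constant c < 0 becomes 1 - (1 - c).
asDifference : Poly p → Difference p
asDifference (var i) = node plus one (input i) , one
asDifference (con (+ n)) = numeral n , one
asDifference (con -[1+ n ]) = one , numeral (suc n)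
asDifference (a ⊕ b) = asDifference a ⊕ᵈ asDifference b
asDifference (a ⊗ b) = asDifference a ⊗ᵈ asDifference b

⟦⊕ᵈ⟧ : ∀ (d e : Difference p) x → ⟦ d ⊕ᵈ e ⟧ᵈ x ≡ ⟦ d ⟧ᵈ x ℤ.+ ⟦ e ⟧ᵈ x
⟦⊕ᵈ⟧ (a , b) (c , d) x = begin
  + (A + C) - + (B + D)         ≡⟨ cong₂ _-_ (pos-+ A C) (pos-+ B D) ⟩
  (+ A ℤ.+ + C) - (+ B ℤ.+ + D)  ≡⟨ regroup (+ A) (+ B) (+ C) (+ D) ⟩
  (+ A - + B) ℤ.+ (+ C - + D)    ∎
  where
  open ≡-Reasoning
  A = ⟦ a ⟧ x ; B = ⟦ b ⟧ x ; C = ⟦ c ⟧ x ; D = ⟦ d ⟧ x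
  regroup : ∀ a b c d → (a ℤ.+ c) - (b ℤ.+ d) ≡ (a - b) ℤ.+ (c - d)
  regroup = ℤ-Solver.solve-∀

⟦⊗ᵈ⟧ : ∀ (d e : Difference p) x → ⟦ d ⊗ᵈ e ⟧ᵈ x ≡ ⟦ d ⟧ᵈ x ℤ.* ⟦ e ⟧ᵈ x
⟦⊗ᵈ⟧ (a , b) (c , d) x = begin
  + (A * C + B * D) - + (A * D + B * C)
    ≡⟨ cong₂ _-_ (pos-sum-of-products A C B D) (pos-sum-of-products A D B C) ⟩
  (+ A ℤ.* + C ℤ.+ + B ℤ.* + D) - (+ A ℤ.* + D ℤ.+ + B ℤ.* + C)
    ≡⟨ expand (+ A) (+ B) (+ C) (+ D) ⟩
  (+ A - + B) ℤ.* (+ C - + D) ∎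
  where
  open ≡-Reasoning
  A = ⟦ a ⟧ x ; B = ⟦ b ⟧ x ; C = ⟦ c ⟧ x ; D = ⟦ d ⟧ x
  pos-sum-of-products : ∀ a b c d → + (a * b + c * d) ≡ + a ℤ.* + b ℤ.+ + c ℤ.* + d
  pos-sum-of-products a b c d = trans (pos-+ (a * b) (c * d)) (cong₂ ℤ._+_ (pos-* a b) (pos-* c d))
  expand : ∀ a b c d → (a ℤ.* c ℤ.+ b ℤ.* d) - (a ℤ.* d ℤ.+ b ℤ.* c) ≡ (a - b) ℤ.* (c - d)
  expand = ℤ-Solver.solve-∀

eval-asDifference : ∀ (D : Poly p) x → eval D x ≡ ⟦ asDifference D ⟧ᵈ x
eval-asDifference (var i) x = refl
eval-asDifference (con (+ n)) x = cong (λ m → + m - + 1) (sym (⟦numeral⟧ n x))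
eval-asDifference (con -[1+ n ]) x = cong (λ m → + 1 - + m) (sym (⟦numeral⟧ (suc n) x))
eval-asDifference (a ⊕ b) x =
  trans (cong₂ ℤ._+_ (eval-asDifference a x) (eval-asDifference b x)) (sym (⟦⊕ᵈ⟧ (asDifference a) (asDifference b) x))
eval-asDifference (a ⊗ b) x =
  trans (cong₂ ℤ._*_ (eval-asDifference a x) (eval-asDifference b x)) (sym (⟦⊗ᵈ⟧ (asDifference a) (asDifference b) x))

encode : (V → Fin n) → Equation V → Eqn n
encode g (inc x y) = addOne (g x) (g y)
encode g (mul x y z) = mulEq (g x) (g y) (g z)

encode⁺ : ∀ {y : Vec ℕ n} (g : V → Fin n) es → lookup y ∘ g ⊨ es → All (λ e → Holds e y) (map (encode g) es)
encode⁺ g [] [] = []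
encode⁺ g (inc x y ∷ es) (h ∷ hs) = h ∷ encode⁺ g es hs
encode⁺ g (mul x y z ∷ es) (h ∷ hs) = h ∷ encode⁺ g es hs

encode⁻ : ∀ {y : Vec ℕ n} (g : V → Fin n) es → All (λ e → Holds e y) (map (encode g) es) → lookup y ∘ g ⊨ es
encode⁻ g [] [] = []
encode⁻ g (inc x y ∷ es) (h ∷ hs) = h ∷ encode⁻ g es hs
encode⁻ g (mul x y z ∷ es) (h ∷ hs) = h ∷ encode⁻ g es hs

finitelyMany-cover : ∀ {m} (g : Vec ℕ m → Vec ℕ n) {P : Vec ℕ m → Set} {Q : Vec ℕ n → Set} →
                     (∀ y → Q y → Σ (Vec ℕ m) λ x → P x × y ≡ g x) → FinitelyMany P → FinitelyMany Q
finitelyMany-cover g cover (xs , complete) = map g xs , covered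
  where
  covered : ∀ y → _ → y ∈ map g xs
  covered y Qy with cover y Qy
  ... | x , Px , refl = ∈-map⁺ g (complete x Px)

m*m≡m⇒m≡1 : ∀ m → 1 ≤ m → m * m ≡ m → m ≡ 1
m*m≡m⇒m≡1 m@(suc _) _ eq = *-cancelʳ-≡ m 1 m (trans eq (sym (*-identityˡ m)))

module Reduction (D : Poly p) where

  lhs rhs : Term p
  lhs = proj₁ (asDifference D)
  rhs = proj₂ (asDifference D)

  -- The product node only serves to gather the variables of both sides into one system.
  whole : Term p
  whole = node times lhs rhs

  lhs-var rhs-var : Var whole
  lhs-var = left {o = times} {u = rhs} (output lhs)
  rhs-var = right {o = times} {t = lhs} (output rhs)

  system : List (Equation (Var whole))
  system = mul one-var one-var one-var ∷ mul lhs-var one-var rhs-var ∷ equations whole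

  dimension : ℕ
  dimension = size (varCode whole)

  numbering : Var whole ↔ Fin dimension
  numbering = El↔Fin (varCode whole)

  index : Var whole → Fin dimension
  index = Inverse.to numbering

  decode : Fin dimension → Var whole
  decode = Inverse.from numbering

  T : List (Eqn dimension)
  T = map (encode index) system

  extend : Vec ℕ p → Vec ℕ dimension
  extend x = tabulate (canonical whole x ∘ decode)

  lookup-extend : ∀ x w → lookup (extend x) (index w) ≡ canonical whole x w
  lookup-extend x w = trans (lookup∘tabulate (canonical whole x ∘ decode) (index w))
    (cong (canonical whole x) (Inverse.strictlyInverseʳ numbering w))

  lhs-value : ∀ x → canonical whole x lhs-var ≡ ⟦ lhs ⟧ x
  lhs-value x = trans (canonical-left {o = times} {u = rhs} x (output lhs)) (canonical-output lhs x)

  rhs-value : ∀ x → canonical whole x rhs-var ≡ ⟦ rhs ⟧ x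
  rhs-value x = trans (canonical-right {o = times} {t = lhs} x (output rhs)) (canonical-output rhs x)

  extend-solves : ∀ x → PolySol D x → SysSol T (extend x)
  extend-solves x (positive , D≡0) = extend-positive ,
    encode⁺ index system (⊨-resp-≗ (sym ∘ lookup-extend x) (refl ∷ sides-equal ∷ canonical-satisfies whole x))
    where
    open ≡-Reasoning
    extend-positive : Positive (extend x)
    extend-positive j = subst (1 ≤_) (sym (lookup∘tabulate (canonical whole x ∘ decode) j))
                          (canonical-positive whole positive (decode j))
    sides-equal : canonical whole x lhs-var * 1 ≡ canonical whole x rhs-var
    sides-equal = begin
      canonical whole x lhs-var * 1  ≡⟨ *-identityʳ _ ⟩
      canonical whole x lhs-var      ≡⟨ lhs-value x ⟩
      ⟦ lhs ⟧ x                      ≡⟨ +-injective (i-j≡0⇒i≡j _ _ (trans (sym (eval-asDifference D x)) D≡0)) ⟩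
      ⟦ rhs ⟧ x                      ≡⟨ rhs-value x ⟨
      canonical whole x rhs-var      ∎

  solution-unique : ∀ y → SysSol T y → Σ (Vec ℕ p) λ x → PolySol D x × y ≡ extend x
  solution-unique y (positive , hs) = x , (x-positive , D≡0) , y≡extend
    where
    open ≡-Reasoning
    v : Var whole → ℕ
    v = lookup y ∘ index
    v-system : v ⊨ system
    v-system = encode⁻ index system hs
    v-one : v one-var ≡ 1
    v-one = m*m≡m⇒m≡1 _ (positive (index one-var)) (All.head v-system)
    x : Vec ℕ p
    x = tabulate (λ i → v (input-var i))
    v≗canonical : v ≗ canonical whole x
    v≗canonical = canonical-unique whole v x (λ i → sym (lookup∘tabulate _ i)) v-one (positive ∘ index)
                    (All.tail (All.tail v-system))
    x-positive : Positive x
    x-positive i = subst (1 ≤_) (sym (lookup∘tabulate _ i)) (positive (index (input-var i)))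
    sides-equal : ⟦ lhs ⟧ x ≡ ⟦ rhs ⟧ x
    sides-equal = begin
      ⟦ lhs ⟧ x              ≡⟨ trans (v≗canonical lhs-var) (lhs-value x) ⟨
      v lhs-var              ≡⟨ *-identityʳ _ ⟨
      v lhs-var * 1          ≡⟨ cong (v lhs-var *_) v-one ⟨
      v lhs-var * v one-var  ≡⟨ All.head (All.tail v-system) ⟩
      v rhs-var              ≡⟨ trans (v≗canonical rhs-var) (rhs-value x) ⟩
      ⟦ rhs ⟧ x              ∎
    D≡0 : eval D x ≡ ℤ.0ℤ
    D≡0 = trans (eval-asDifference D x) (i≡j⇒i-j≡0 (cong +_ sides-equal))
    y≡extend : y ≡ extend x
    y≡extend = trans (sym (tabulate∘lookup y)) (tabulate-cong λ j →
      trans (cong (lookup y) (sym (Inverse.strictlyInverseˡ numbering j))) (v≗canonical (decode j)))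

theorem3 : Conjecture →
    Σ ((p : ℕ) → Poly p → ℕ) λ B →
      ∀ (p : ℕ) (D : Poly p) → FinitelyMany (PolySol D) →
        ∀ x → PolySol D x → ∀ i → lookup x i ≤ B p D
theorem3 conjecture = (λ p D → f (Reduction.dimension D)) , bound
  where
  bound : ∀ p (D : Poly p) → FinitelyMany (PolySol D) →
          ∀ x → PolySol D x → ∀ i → lookup x i ≤ f (Reduction.dimension D)
  bound p D finite x solution i = begin
    lookup x i                               ≡⟨ lookup-extend x (input-var i) ⟨
    lookup (extend x) (index (input-var i))
      ≤⟨ conjecture dimension (s≤s z≤n) T (finitelyMany-cover extend solution-unique finite)
                    (extend x) (extend-solves x solution) (index (input-var i)) ⟩
    f dimension                              ∎
    where
    open Reduction D
    open ≤-Reasoning
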